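{- For every integer $n\ge 0$, $$F(n)=\sum_{k=0}^\infty\sum_{l=0}^\infty\frac{1}{2^{k+l+2}}\binom{kl}{n},$$ where $F(n)$ is the number of incidence matrices with exactly $n$ ones.
   Context: An incidence matrix is a zero-one matrix with no zero rows and no zero columns. For $n\in\mathbb N$, $F(n)$ is the number of incidence matrices (of any size) with exactly $n$ ones; by convention $F(0)=1$. Here $\binom{m}{n}=0$ if $m<n$. -}

module Defs where

open import Data.Bool using (Bool; true; false; _∧_; _∨_)
open import Data.Nat using (ℕ; zero; suc; _+_; _*_)
open import Data.Nat.Combinatorics using (_C_)
open import Data.Integer using (+_)
open import Data.Product using (Σ; _×_)
open import Data.Vec using (Vec; []; _∷_; transpose)
open import Data.Rational using (ℚ; _/_; 1ℚ; 0ℚ; ½) renaming (_+_ to _+ℚ_; _*_ to _*ℚ_)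
open import Relation.Binary.PropositionalEquality using (_≡_)

Mat : ℕ → ℕ → Set
Mat m p = Vec (Vec Bool p) m

onesRow : ∀ {p} → Vec Bool p → ℕ
onesRow []          = 0
onesRow (true ∷ r)  = suc (onesRow r)
onesRow (false ∷ r) = onesRow r

ones : ∀ {m p} → Mat m p → ℕ
ones []      = 0
ones (r ∷ M) = onesRow r + ones M

nonzeroRow : ∀ {p} → Vec Bool p → Bool
nonzeroRow []      = false
nonzeroRow (b ∷ r) = b ∨ nonzeroRow r

noZeroRows : ∀ {m p} → Mat m p → Bool
noZeroRows []      = true
noZeroRows (r ∷ M) = nonzeroRow r ∧ noZeroRows M

isIncidence : ∀ {m p} → Mat m p → Bool
isIncidence M = noZeroRows M ∧ noZeroRows (transpose M)

-- The set of incidence matrices (of any size m × p) with exactly n ones.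
-- Both side conditions are equalities in Bool / ℕ, hence propositions,
-- so elements correspond exactly to matrices.
IncMat : ℕ → Set
IncMat n = Σ ℕ λ m → Σ ℕ λ p → Σ (Mat m p) λ M →
             (isIncidence M ≡ true) × (ones M ≡ n)

halfPow : ℕ → ℚ
halfPow zero    = 1ℚ
halfPow (suc e) = ½ *ℚ halfPow e

term : ℕ → ℕ → ℕ → ℚ
term n k l = ((+ ((k * l) C n)) / 1) *ℚ halfPow (k + l + 2)

sumTo : ℕ → (ℕ → ℚ) → ℚ
sumTo zero    f = 0ℚ
sumTo (suc K) f = sumTo K f +ℚ f K

partial : ℕ → ℕ → ℚ
partial n K = sumTo K (λ k → sumTo K (λ l → term n k l))

{-# OPTIONS --safe #-}
module Submission where

-- Recording which rows and which columns of a k × l zero-one matrix are nonzero is a bijection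
-- onto triples (row set, column set, incidence matrix on them), so
-- C(kl, n) = Σ_{i,j ≤ n} C(k,i) C(l,j) F(n,i,j), where F(n,i,j) (incidenceCount) counts the
-- i × j incidence matrices with n ones; they exist only for i, j ≤ n. Since
-- Σ_k C(k,i) / 2^(k+1) = 1 for every i, the double series sums to Σ_{i,j} F(n,i,j) = F(n).
-- For the rate, scale the K-th square partial sum by 4^K: it becomes Σ_{i,j} F(n,i,j) A_i A_j,
-- where A_i = Σ_{k<K} C(k,i) 2^(K-1-k) (columnSum) and S_i = Σ_{j≤i} C(K,j) (rowPrefix) add up
-- to 2^K. As K S_n ≤ 2(n+1) 2^K, the partial sums are within O(1/K) of F(n).

open import Data.Nat using (ℕ)
open import Defs

module FiniteSums where

  open import Data.Nat using (zero; suc; _+_; _*_; _≤_; _<_; _≤′_; ≤′-refl; ≤′-step; z≤n)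
  open import Data.Nat.Properties
  open import Data.Nat.Solver using (module +-*-Solver)
  open import Relation.Binary.PropositionalEquality
  open +-*-Solver using (solve; _:+_; _:=_)

  ∑< : ℕ → (ℕ → ℕ) → ℕ
  ∑< zero    f = 0
  ∑< (suc K) f = ∑< K f + f K

  syntax ∑< K (λ k → e) = ∑[ k < K ] e

  ∑-cong : ∀ K {f g : ℕ → ℕ} → (∀ k → k < K → f k ≡ g k) → ∑< K f ≡ ∑< K g
  ∑-cong zero    f≗g = refl
  ∑-cong (suc K) f≗g = cong₂ _+_ (∑-cong K λ k k<K → f≗g k (m<n⇒m<1+n k<K)) (f≗g K ≤-refl)

  ∑-mono-≤ : ∀ K {f g : ℕ → ℕ} → (∀ k → k < K → f k ≤ g k) → ∑< K f ≤ ∑< K g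
  ∑-mono-≤ zero    f≤g = z≤n
  ∑-mono-≤ (suc K) f≤g = +-mono-≤ (∑-mono-≤ K λ k k<K → f≤g k (m<n⇒m<1+n k<K)) (f≤g K ≤-refl)

  ∑-mono-range : ∀ {a b} (f : ℕ → ℕ) → a ≤ b → ∑< a f ≤ ∑< b f
  ∑-mono-range {a} f a≤b = extend (≤⇒≤′ a≤b)
    where
    extend : ∀ {b} → a ≤′ b → ∑< a f ≤ ∑< b f
    extend ≤′-refl        = ≤-refl
    extend (≤′-step a≤′b) = ≤-trans (extend a≤′b) (m≤m+n _ _)

  ∑-cons : ∀ K (f : ℕ → ℕ) → ∑< (suc K) f ≡ f 0 + ∑[ k < K ] f (suc k)
  ∑-cons zero    f = +-comm 0 (f 0)
  ∑-cons (suc K) f = trans (cong (_+ f (suc K)) (∑-cons K f)) (+-assoc (f 0) _ _)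

  ∑-const : ∀ K c → ∑[ k < K ] c ≡ K * c
  ∑-const zero    c = refl
  ∑-const (suc K) c = trans (cong (_+ c) (∑-const K c)) (+-comm (K * c) c)

  ∑-distrib-+ : ∀ K (f g : ℕ → ℕ) → ∑[ k < K ] (f k + g k) ≡ ∑< K f + ∑< K g
  ∑-distrib-+ zero    f g = refl
  ∑-distrib-+ (suc K) f g = trans (cong (_+ (f K + g K)) (∑-distrib-+ K f g))
    (solve 4 (λ a b c d → (a :+ b) :+ (c :+ d) := (a :+ c) :+ (b :+ d)) refl (∑< K f) (∑< K g) (f K) (g K))

  *-distribˡ-∑ : ∀ K c (f : ℕ → ℕ) → c * ∑< K f ≡ ∑[ k < K ] (c * f k)
  *-distribˡ-∑ zero    c f = *-zeroʳ c
  *-distribˡ-∑ (suc K) c f = trans (*-distribˡ-+ c (∑< K f) (f K)) (cong (_+ c * f K) (*-distribˡ-∑ K c f))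

  *-distribʳ-∑ : ∀ K c (f : ℕ → ℕ) → ∑< K f * c ≡ ∑[ k < K ] (f k * c)
  *-distribʳ-∑ zero    c f = refl
  *-distribʳ-∑ (suc K) c f = trans (*-distribʳ-+ c (∑< K f) (f K)) (cong (_+ f K * c) (*-distribʳ-∑ K c f))

  ∑-comm : ∀ K L (f : ℕ → ℕ → ℕ) → ∑[ k < K ] ∑[ l < L ] f k l ≡ ∑[ l < L ] ∑[ k < K ] f k l
  ∑-comm zero    L f = sym (trans (∑-const L 0) (*-zeroʳ L))
  ∑-comm (suc K) L f = trans (cong (_+ ∑< L (f K)) (∑-comm K L f)) (sym (∑-distrib-+ L _ (f K)))

  ∑∑-comm : ∀ K L I J (f : ℕ → ℕ → ℕ → ℕ → ℕ) →
            ∑[ k < K ] ∑[ l < L ] ∑[ i < I ] ∑[ j < J ] f k l i j ≡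
            ∑[ i < I ] ∑[ j < J ] ∑[ k < K ] ∑[ l < L ] f k l i j
  ∑∑-comm K L I J f = begin
    ∑[ k < K ] ∑[ l < L ] ∑[ i < I ] ∑[ j < J ] f k l i j
      ≡⟨ ∑-cong K (λ k _ → ∑-comm L I _) ⟩
    ∑[ k < K ] ∑[ i < I ] ∑[ l < L ] ∑[ j < J ] f k l i j
      ≡⟨ ∑-cong K (λ k _ → ∑-cong I λ i _ → ∑-comm L J _) ⟩
    ∑[ k < K ] ∑[ i < I ] ∑[ j < J ] ∑[ l < L ] f k l i j
      ≡⟨ ∑-comm K I _ ⟩
    ∑[ i < I ] ∑[ k < K ] ∑[ j < J ] ∑[ l < L ] f k l i j
      ≡⟨ ∑-cong I (λ i _ → ∑-comm K J _) ⟩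
    ∑[ i < I ] ∑[ j < J ] ∑[ k < K ] ∑[ l < L ] f k l i j ∎
    where open ≡-Reasoning

  ∑∑-product : ∀ K L c (x y : ℕ → ℕ) →
               ∑[ k < K ] ∑[ l < L ] (c * (x k * y l)) ≡ c * (∑< K x * ∑< L y)
  ∑∑-product K L c x y = sym (begin
    c * (∑< K x * ∑< L y)                    ≡⟨ cong (c *_) (*-distribʳ-∑ K (∑< L y) x) ⟩
    c * ∑[ k < K ] (x k * ∑< L y)            ≡⟨ *-distribˡ-∑ K c _ ⟩
    ∑[ k < K ] (c * (x k * ∑< L y))          ≡⟨ ∑-cong K (λ k _ → cong (c *_) (*-distribˡ-∑ L (x k) y)) ⟩
    ∑[ k < K ] (c * ∑[ l < L ] (x k * y l))  ≡⟨ ∑-cong K (λ k _ → *-distribˡ-∑ L c _) ⟩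
    ∑[ k < K ] ∑[ l < L ] (c * (x k * y l))  ∎)
    where open ≡-Reasoning

module Matrices where

  open import Algebra.Properties.CommutativeSemigroup using (x∙yz≈y∙xz)
  open import Data.Bool using (Bool; true; false; _∧_; _∨_)
  open import Data.Bool.Properties using (∧-conicalˡ; ∧-conicalʳ; ∨-identityˡ)
  open import Data.Nat using (zero; suc; _+_; _*_; _≤_; z≤n; s≤s)
  open import Data.Nat.Properties using (+-mono-≤; +-commutativeSemigroup)
  open import Data.Product using (Σ; _,_; proj₁; proj₂; uncurry)
  open import Data.Vec using (Vec; []; _∷_; _++_; _⊛_; concat; group; map; replicate; transpose; zipWith)
  open import Data.Vec.Properties
    using (++-injective; ∷-injectiveˡ; ∷-injectiveʳ; zipWith-is-⊛; zipWith-identityˡ)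
  open import Relation.Binary.PropositionalEquality
  open import Relation.Nullary using (contradiction)

  private variable
    A : Set
    k l m : ℕ

  onesRow-++ : (u : Vec Bool k) (v : Vec Bool l) → onesRow (u ++ v) ≡ onesRow u + onesRow v
  onesRow-++ []          v = refl
  onesRow-++ (true ∷ u)  v = cong suc (onesRow-++ u v)
  onesRow-++ (false ∷ u) v = onesRow-++ u v

  onesRow-concat : (M : Mat k l) → onesRow (concat M) ≡ ones M
  onesRow-concat []      = refl
  onesRow-concat (r ∷ M) = trans (onesRow-++ r (concat M)) (cong (onesRow r +_) (onesRow-concat M))

  concat-injective : (M N : Vec (Vec A l) k) → concat M ≡ concat N → M ≡ N
  concat-injective []      []      _  = refl
  concat-injective (r ∷ M) (s ∷ N) eq with ++-injective r s eq
  ... | refl , eq′ = cong (r ∷_) (concat-injective M N eq′)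

  unconcat : ∀ k l → Vec A (k * l) → Vec (Vec A l) k
  unconcat k l v = proj₁ (group k l v)

  concat-unconcat : ∀ k l (v : Vec A (k * l)) → concat (unconcat k l v) ≡ v
  concat-unconcat k l v = sym (proj₂ (group k l v))

  unconcat-concat : (M : Vec (Vec A l) k) → unconcat k l (concat M) ≡ M
  unconcat-concat {l = l} {k = k} M = concat-injective _ M (concat-unconcat k l (concat M))

  transpose-∷ : (r : Vec A l) (M : Vec (Vec A l) k) → transpose (r ∷ M) ≡ zipWith _∷_ r (transpose M)
  transpose-∷ r M = sym (zipWith-is-⊛ _∷_ r (transpose M))

  transpose-zipWith-∷ : (r : Vec A k) (T : Vec (Vec A l) k) → transpose (zipWith _∷_ r T) ≡ r ∷ transpose T
  transpose-zipWith-∷ []      []      = refl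
  transpose-zipWith-∷ (x ∷ r) (t ∷ T) = cong (replicate _ _∷_ ⊛ (x ∷ t) ⊛_) (transpose-zipWith-∷ r T)

  transpose-involutive : (M : Vec (Vec A l) k) → transpose (transpose M) ≡ M
  transpose-involutive []      = empty (transpose (transpose []))
    where
    empty : (v : Vec A 0) → v ≡ []
    empty [] = refl
  transpose-involutive (r ∷ M) = begin
    transpose (transpose (r ∷ M))             ≡⟨ cong transpose (transpose-∷ r M) ⟩
    transpose (zipWith _∷_ r (transpose M))   ≡⟨ transpose-zipWith-∷ r (transpose M) ⟩
    r ∷ transpose (transpose M)               ≡⟨ cong (r ∷_) (transpose-involutive M) ⟩
    r ∷ M                                     ∎
    where open ≡-Reasoning

  ones-zipWith-∷ : (r : Vec Bool k) (T : Mat k l) → ones (zipWith _∷_ r T) ≡ onesRow r + ones T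
  ones-zipWith-∷ []          []      = refl
  ones-zipWith-∷ (true ∷ r)  (t ∷ T) =
    cong suc (trans (cong (onesRow t +_) (ones-zipWith-∷ r T))
                    (x∙yz≈y∙xz +-commutativeSemigroup (onesRow t) (onesRow r) (ones T)))
  ones-zipWith-∷ (false ∷ r) (t ∷ T) =
    trans (cong (onesRow t +_) (ones-zipWith-∷ r T))
          (x∙yz≈y∙xz +-commutativeSemigroup (onesRow t) (onesRow r) (ones T))

  ones-transpose : (M : Mat k l) → ones (transpose M) ≡ ones M
  ones-transpose {l = l} [] = ones-empty l
    where
    ones-empty : ∀ l → ones (replicate l ([] {A = Bool})) ≡ 0
    ones-empty zero    = refl
    ones-empty (suc l) = ones-empty l
  ones-transpose (r ∷ M) = begin
    ones (transpose (r ∷ M))            ≡⟨ cong ones (transpose-∷ r M) ⟩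
    ones (zipWith _∷_ r (transpose M))  ≡⟨ ones-zipWith-∷ r (transpose M) ⟩
    onesRow r + ones (transpose M)      ≡⟨ cong (onesRow r +_) (ones-transpose M) ⟩
    onesRow r + ones M                  ∎
    where open ≡-Reasoning

  nonzeroRow⇒1≤onesRow : (r : Vec Bool l) → nonzeroRow r ≡ true → 1 ≤ onesRow r
  nonzeroRow⇒1≤onesRow (true ∷ r)  _  = s≤s z≤n
  nonzeroRow⇒1≤onesRow (false ∷ r) nz = nonzeroRow⇒1≤onesRow r nz

  noZeroRows⇒rows≤ones : (M : Mat k l) → noZeroRows M ≡ true → k ≤ ones M
  noZeroRows⇒rows≤ones []      _  = z≤n
  noZeroRows⇒rows≤ones (r ∷ M) nz =
    +-mono-≤ (nonzeroRow⇒1≤onesRow r (∧-conicalˡ _ _ nz)) (noZeroRows⇒rows≤ones M (∧-conicalʳ _ _ nz))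

  nonzeroRow-replicate : ∀ l → nonzeroRow (replicate l false) ≡ false
  nonzeroRow-replicate zero    = refl
  nonzeroRow-replicate (suc l) = nonzeroRow-replicate l

  onesRow-replicate : ∀ l → onesRow (replicate l false) ≡ 0
  onesRow-replicate zero    = refl
  onesRow-replicate (suc l) = onesRow-replicate l

  nonzeroRow≡false⇒replicate : (r : Vec Bool l) → nonzeroRow r ≡ false → r ≡ replicate l false
  nonzeroRow≡false⇒replicate []          _ = refl
  nonzeroRow≡false⇒replicate (false ∷ r) z = cong (false ∷_) (nonzeroRow≡false⇒replicate r z)

  padZeroRows : (R : Vec Bool k) → Mat (onesRow R) l → Mat k l
  padZeroRows []          []      = []
  padZeroRows (true ∷ R)  (r ∷ N) = r ∷ padZeroRows R N
  padZeroRows (false ∷ R) N       = replicate _ false ∷ padZeroRows R N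

  dropZeroRows : Mat k l → Σ (Vec Bool k) λ R → Mat (onesRow R) l
  dropZeroRows []      = [] , []
  dropZeroRows (r ∷ M) with nonzeroRow r | dropZeroRows M
  ... | true  | R , N = true ∷ R , r ∷ N
  ... | false | R , N = false ∷ R , N

  padZeroRows-dropZeroRows : (M : Mat k l) → uncurry padZeroRows (dropZeroRows M) ≡ M
  padZeroRows-dropZeroRows []      = refl
  padZeroRows-dropZeroRows (r ∷ M) with nonzeroRow r in nz | dropZeroRows M | padZeroRows-dropZeroRows M
  ... | true  | R , N | pad-drop = cong (r ∷_) pad-drop
  ... | false | R , N | pad-drop = cong₂ _∷_ (sym (nonzeroRow≡false⇒replicate r nz)) pad-drop

  dropZeroRows-padZeroRows : (R : Vec Bool k) (N : Mat (onesRow R) l) → noZeroRows N ≡ true →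
                             dropZeroRows (padZeroRows R N) ≡ (R , N)
  dropZeroRows-padZeroRows []          []      _  = refl
  dropZeroRows-padZeroRows (true ∷ R)  (r ∷ N) nz
    with nonzeroRow r in r≢0 | dropZeroRows (padZeroRows R N) | dropZeroRows-padZeroRows R N (∧-conicalʳ _ _ nz)
  ... | true  | _ | refl = refl
  ... | false | _ | _    = contradiction (trans (sym r≢0) (∧-conicalˡ _ _ nz)) λ ()
  dropZeroRows-padZeroRows {l = l} (false ∷ R) N nz rewrite nonzeroRow-replicate l
    with dropZeroRows (padZeroRows R N) | dropZeroRows-padZeroRows R N nz
  ... | _ | refl = refl

  noZeroRows-dropZeroRows : (M : Mat k l) → noZeroRows (proj₂ (dropZeroRows M)) ≡ true
  noZeroRows-dropZeroRows []      = refl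
  noZeroRows-dropZeroRows (r ∷ M) with nonzeroRow r in r≢0 | dropZeroRows M | noZeroRows-dropZeroRows M
  ... | true  | R , N | nz = trans (cong (_∧ noZeroRows N) r≢0) nz
  ... | false | R , N | nz = nz

  ones-padZeroRows : (R : Vec Bool k) (N : Mat (onesRow R) l) → ones (padZeroRows R N) ≡ ones N
  ones-padZeroRows []          []      = refl
  ones-padZeroRows (true ∷ R)  (r ∷ N) = cong (onesRow r +_) (ones-padZeroRows R N)
  ones-padZeroRows {l = l} (false ∷ R) N = cong₂ _+_ (onesRow-replicate l) (ones-padZeroRows R N)

  noZeroRows-cong : (M : Mat k l) (N : Mat k m) → map nonzeroRow M ≡ map nonzeroRow N →
                    noZeroRows M ≡ noZeroRows N
  noZeroRows-cong []      []      _  = refl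
  noZeroRows-cong (r ∷ M) (s ∷ N) eq =
    cong₂ _∧_ (∷-injectiveˡ eq) (noZeroRows-cong M N (∷-injectiveʳ eq))

  columnSupport : Mat k l → Vec Bool l
  columnSupport M = map nonzeroRow (transpose M)

  columnSupport-∷ : (r : Vec Bool l) (M : Mat k l) → columnSupport (r ∷ M) ≡ zipWith _∨_ r (columnSupport M)
  columnSupport-∷ r M = trans (cong (map nonzeroRow) (transpose-∷ r M)) (map-zipWith-∷ r (transpose M))
    where
    map-zipWith-∷ : (r : Vec Bool l) (T : Mat l k) →
                    map nonzeroRow (zipWith _∷_ r T) ≡ zipWith _∨_ r (map nonzeroRow T)
    map-zipWith-∷ []      []      = refl
    map-zipWith-∷ (x ∷ r) (t ∷ T) = cong ((x ∨ nonzeroRow t) ∷_) (map-zipWith-∷ r T)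

  columnSupport-padZeroRows : (R : Vec Bool k) (N : Mat (onesRow R) l) →
                              columnSupport (padZeroRows R N) ≡ columnSupport N
  columnSupport-padZeroRows []          []      = refl
  columnSupport-padZeroRows (true ∷ R)  (r ∷ N) = begin
    columnSupport (r ∷ padZeroRows R N)              ≡⟨ columnSupport-∷ r (padZeroRows R N) ⟩
    zipWith _∨_ r (columnSupport (padZeroRows R N))  ≡⟨ cong (zipWith _∨_ r) (columnSupport-padZeroRows R N) ⟩
    zipWith _∨_ r (columnSupport N)                  ≡⟨ columnSupport-∷ r N ⟨
    columnSupport (r ∷ N)                            ∎
    where open ≡-Reasoning
  columnSupport-padZeroRows (false ∷ R) N       = begin
    columnSupport (replicate _ false ∷ padZeroRows R N)
      ≡⟨ columnSupport-∷ (replicate _ false) (padZeroRows R N) ⟩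
    zipWith _∨_ (replicate _ false) (columnSupport (padZeroRows R N))
      ≡⟨ zipWith-identityˡ ∨-identityˡ _ ⟩
    columnSupport (padZeroRows R N)
      ≡⟨ columnSupport-padZeroRows R N ⟩
    columnSupport N ∎
    where open ≡-Reasoning

  noZeroColumns-padZeroRows : (R : Vec Bool k) (N : Mat (onesRow R) l) →
                              noZeroRows (transpose (padZeroRows R N)) ≡ noZeroRows (transpose N)
  noZeroColumns-padZeroRows R N = noZeroRows-cong _ _ (columnSupport-padZeroRows R N)

module Counting where

  open import Axiom.UniquenessOfIdentityProofs.WithK using (uip)
  open import Data.Bool using (Bool; true; false)
  open import Data.Empty using (⊥-elim)
  open import Data.Fin using (Fin; zero)
  open import Data.Fin.Properties using (+↔⊎; *↔×)
  open import Data.Nat using (zero; suc; _+_; _*_; _≤_; _<_; z≤n; s≤s)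
  open import Data.Nat.Combinatorics using (_C_; nCk+nC[k+1]≡[n+1]C[k+1])
  open import Data.Nat.Properties using (suc-injective)
  open import Data.Product using (Σ; _×_; _,_)
  open import Data.Product.Function.Dependent.Propositional using (Σ-↔)
  open import Data.Product.Function.NonDependent.Propositional using (_×-↔_)
  open import Data.Sum using (_⊎_; inj₁; inj₂)
  open import Data.Sum.Function.Propositional using (_⊎-↔_)
  open import Data.Vec using (Vec; []; _∷_)
  open import Function using (_∘_)
  open import Function.Bundles using (_↔_; mk↔ₛ′)
  open import Function.Properties.Inverse using (↔-refl; ↔-sym; ↔-trans)
  open import Function.Related.Propositional using (module EquationalReasoning)
  open import Relation.Binary.PropositionalEquality
  open import Relation.Nullary using (¬_; Dec; yes; no; Irrelevant)

  open FiniteSums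

  private variable
    A : Set
    k : ℕ

  Σ-congʳ : {B C : A → Set} → (∀ {a} → B a ↔ C a) → Σ A B ↔ Σ A C
  Σ-congʳ = Σ-↔ ↔-refl

  ¬⇒↔Fin0 : ¬ A → A ↔ Fin 0
  ¬⇒↔Fin0 ¬a = mk↔ₛ′ (⊥-elim ∘ ¬a) (λ ()) (λ ()) (⊥-elim ∘ ¬a)

  Σ-Bool-↔ : {B : Bool → Set} → Σ Bool B ↔ (B true ⊎ B false)
  Σ-Bool-↔ {B} = mk↔ₛ′ split join (λ { (inj₁ _) → refl ; (inj₂ _) → refl })
                                  (λ { (true , _) → refl ; (false , _) → refl })
    where
    split : Σ Bool B → B true ⊎ B false
    split (true  , b) = inj₁ b
    split (false , b) = inj₂ b
    join : B true ⊎ B false → Σ Bool B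
    join (inj₁ b) = true  , b
    join (inj₂ b) = false , b

  Σ-ℕ-↔ : {B : ℕ → Set} → Σ ℕ B ↔ (B 0 ⊎ Σ ℕ (B ∘ suc))
  Σ-ℕ-↔ {B} = mk↔ₛ′ split join (λ { (inj₁ _) → refl ; (inj₂ _) → refl })
                               (λ { (zero , _) → refl ; (suc _ , _) → refl })
    where
    split : Σ ℕ B → B 0 ⊎ Σ ℕ (B ∘ suc)
    split (zero  , b) = inj₁ b
    split (suc m , b) = inj₂ (m , b)
    join : B 0 ⊎ Σ ℕ (B ∘ suc) → Σ ℕ B
    join (inj₁ b)       = zero , b
    join (inj₂ (m , b)) = suc m , b

  Σ-Vec-[]-↔ : {B : Vec A 0 → Set} → Σ (Vec A 0) B ↔ B []
  Σ-Vec-[]-↔ = mk↔ₛ′ (λ { ([] , b) → b }) ([] ,_) (λ _ → refl) (λ { ([] , _) → refl })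

  Σ-Vec-∷-↔ : {B : Vec A (suc k) → Set} → Σ (Vec A (suc k)) B ↔ Σ A λ a → Σ (Vec A k) λ v → B (a ∷ v)
  Σ-Vec-∷-↔ = mk↔ₛ′ (λ { (a ∷ v , b) → a , v , b }) (λ (a , v , b) → a ∷ v , b) (λ _ → refl)
                    (λ { (_ ∷ _ , _) → refl })

  Σ-fibres-↔ : (f : A → ℕ) {B : ℕ → Set} → Σ A (B ∘ f) ↔ Σ ℕ λ i → Σ A (λ a → f a ≡ i) × B i
  Σ-fibres-↔ {A = A} f {B} = mk↔ₛ′ into (λ { (_ , (a , refl) , b) → a , b })
                                        (λ { (_ , (_ , refl) , _) → refl }) (λ _ → refl)
    where
    into : Σ A (B ∘ f) → Σ ℕ λ i → Σ A (λ a → f a ≡ i) × B i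
    into (a , b) = f a , (a , refl) , b

  record Enumerable (A : Set) : Set where
    field
      sum     : (A → ℕ) → ℕ
      Σ-Fin-↔ : (b : A → ℕ) → Σ A (Fin ∘ b) ↔ Fin (sum b)

    Σ-↔-Fin : {B : A → Set} (b : A → ℕ) → (∀ a → B a ↔ Fin (b a)) → Σ A B ↔ Fin (sum b)
    Σ-↔-Fin b B↔b = ↔-trans (Σ-congʳ (B↔b _)) (Σ-Fin-↔ b)

  open Enumerable

  Bool-enumerable : Enumerable Bool
  sum     Bool-enumerable b = b true + b false
  Σ-Fin-↔ Bool-enumerable b = ↔-trans Σ-Bool-↔ (↔-sym +↔⊎)

  Vec-enumerable : Enumerable A → ∀ k → Enumerable (Vec A k)
  sum     (Vec-enumerable E zero)    b = b []
  sum     (Vec-enumerable E (suc k)) b = sum E λ a → sum (Vec-enumerable E k) (b ∘ (a ∷_))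
  Σ-Fin-↔ (Vec-enumerable E zero)    b = Σ-Vec-[]-↔
  Σ-Fin-↔ (Vec-enumerable E (suc k)) b =
    ↔-trans Σ-Vec-∷-↔ (Σ-↔-Fin E _ λ a → Σ-Fin-↔ (Vec-enumerable E k) (b ∘ (a ∷_)))

  indicator : {P : Set} → Dec P → ℕ
  indicator (yes _) = 1
  indicator (no _)  = 0

  Dec-↔-Fin : {P : Set} → Irrelevant P → (P? : Dec P) → P ↔ Fin (indicator P?)
  Dec-↔-Fin irr (yes p) = mk↔ₛ′ (λ _ → zero) (λ _ → p) (λ { zero → refl }) (irr p)
  Dec-↔-Fin irr (no ¬p) = ¬⇒↔Fin0 ¬p

  Σℕ-↔-Fin : ∀ N {B : ℕ → Set} (b : ℕ → ℕ) →
             (∀ m → m < N → B m ↔ Fin (b m)) → (∀ m → N ≤ m → ¬ B m) → Σ ℕ B ↔ Fin (∑< N b)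
  Σℕ-↔-Fin zero    b B↔b B-empty = ¬⇒↔Fin0 λ (m , x) → B-empty m z≤n x
  Σℕ-↔-Fin (suc N) {B} b B↔b B-empty = begin
    Σ ℕ B                                    ↔⟨ Σ-ℕ-↔ ⟩
    (B 0 ⊎ Σ ℕ (B ∘ suc))
      ↔⟨ B↔b 0 (s≤s z≤n) ⊎-↔ Σℕ-↔-Fin N (b ∘ suc) B∘suc↔b B∘suc-empty ⟩
    (Fin (b 0) ⊎ Fin (∑[ m < N ] b (suc m))) ↔⟨ +↔⊎ ⟨
    Fin (b 0 + ∑[ m < N ] b (suc m))         ≡⟨ cong Fin (∑-cons N b) ⟨
    Fin (∑< (suc N) b)                       ∎
    where
    open EquationalReasoning
    B∘suc↔b : ∀ m → m < N → B (suc m) ↔ Fin (b (suc m))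
    B∘suc↔b m m<N = B↔b (suc m) (s≤s m<N)
    B∘suc-empty : ∀ m → N ≤ m → ¬ B (suc m)
    B∘suc-empty m N≤m = B-empty (suc m) (s≤s N≤m)

  suc-≡-↔ : {m n : ℕ} → (suc m ≡ suc n) ↔ (m ≡ n)
  suc-≡-↔ = mk↔ₛ′ suc-injective (cong suc) (λ _ → uip _ _) (λ _ → uip _ _)

  binomial-↔ : ∀ N n → Σ (Vec Bool N) (λ v → onesRow v ≡ n) ↔ Fin (N C n)
  binomial-↔ zero    zero    =
    mk↔ₛ′ (λ _ → zero) (λ _ → [] , refl) (λ { zero → refl }) (λ { ([] , refl) → refl })
  binomial-↔ zero    (suc n) = ¬⇒↔Fin0 λ { ([] , ()) }
  binomial-↔ (suc N) zero    = begin
    Σ (Vec Bool (suc N)) (λ v → onesRow v ≡ 0)               ↔⟨ Σ-Vec-∷-↔ ⟩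
    Σ Bool (λ b → Σ (Vec Bool N) λ v → onesRow (b ∷ v) ≡ 0)  ↔⟨ Σ-Bool-↔ ⟩
    (Σ (Vec Bool N) (λ v → suc (onesRow v) ≡ 0) ⊎ Σ (Vec Bool N) (λ v → onesRow v ≡ 0))
      ↔⟨ ¬⇒↔Fin0 (λ { (_ , ()) }) ⊎-↔ binomial-↔ N 0 ⟩
    (Fin 0 ⊎ Fin (N C 0))                                    ↔⟨ +↔⊎ ⟨
    Fin (suc N C 0)                                          ∎
    where open EquationalReasoning
  binomial-↔ (suc N) (suc n) = begin
    Σ (Vec Bool (suc N)) (λ v → onesRow v ≡ suc n)               ↔⟨ Σ-Vec-∷-↔ ⟩
    Σ Bool (λ b → Σ (Vec Bool N) λ v → onesRow (b ∷ v) ≡ suc n)  ↔⟨ Σ-Bool-↔ ⟩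
    (Σ (Vec Bool N) (λ v → suc (onesRow v) ≡ suc n) ⊎ Σ (Vec Bool N) (λ v → onesRow v ≡ suc n))
      ↔⟨ ↔-trans (Σ-congʳ suc-≡-↔) (binomial-↔ N n) ⊎-↔ binomial-↔ N (suc n) ⟩
    (Fin (N C n) ⊎ Fin (N C suc n))                              ↔⟨ +↔⊎ ⟨
    Fin (N C n + N C suc n)                                      ≡⟨ cong Fin (nCk+nC[k+1]≡[n+1]C[k+1] N n) ⟩
    Fin (suc N C suc n)                                          ∎
    where open EquationalReasoning

  Σ-onesRow-↔-Fin : ∀ k N {B : ℕ → Set} (b : ℕ → ℕ) →
                    (∀ i → i < N → B i ↔ Fin (b i)) → (∀ i → N ≤ i → ¬ B i) →
                    Σ (Vec Bool k) (B ∘ onesRow) ↔ Fin (∑[ i < N ] ((k C i) * b i))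
  Σ-onesRow-↔-Fin k N b B↔b B-empty = ↔-trans (Σ-fibres-↔ onesRow)
    (Σℕ-↔-Fin N _ (λ i i<N → ↔-trans (binomial-↔ k i ×-↔ B↔b i i<N) (↔-sym *↔×))
                  (λ i N≤i (_ , x) → B-empty i N≤i x))

module IncidenceMatrices where

  open import Axiom.UniquenessOfIdentityProofs.WithK using (uip)
  open import Data.Bool using (Bool; true; false; _∧_) renaming (_≟_ to _≟ᵇ_)
  open import Data.Bool.Properties using (∧-conicalˡ; ∧-conicalʳ)
  open import Data.Fin using (Fin)
  open import Data.Fin.Permutation using (↔⇒≡)
  open import Data.Nat using (suc; _*_; _≤_; _<_; _≟_)
  open import Data.Nat.Combinatorics using (_C_)
  open import Data.Nat.Properties using (<⇒≱)
  open import Data.Product using (Σ; _×_; _,_; proj₁)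
  open import Data.Product.Function.Dependent.Propositional using (Σ-↔)
  open import Data.Vec using (Vec; concat; transpose)
  open import Function using (_∘_)
  open import Function.Bundles using (_↔_; mk↔ₛ′)
  open import Function.Properties.Inverse using (↔-trans)
  open import Function.Related.Propositional using (module EquationalReasoning; K-reflexive)
  open import Function.Related.TypeIsomorphisms using (Σ-assoc)
  open import Relation.Binary.PropositionalEquality
  open import Relation.Nullary using (¬_; Dec; Irrelevant; _×-dec_)

  open FiniteSums
  open Matrices
  open Counting
  open Enumerable

  private variable
    A : Set
    k l : ℕ

  Σ-≡-irrelevant : {B : A → Set} → (∀ {a} → Irrelevant (B a)) →
                   {x y : Σ A B} → proj₁ x ≡ proj₁ y → x ≡ y
  Σ-≡-irrelevant irr {a , p} {.a , q} refl = cong (a ,_) (irr p q)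

  concat-↔ : Vec (Vec A l) k ↔ Vec A (k * l)
  concat-↔ {l = l} {k = k} = mk↔ₛ′ concat (unconcat k l) (concat-unconcat k l) unconcat-concat

  transpose-↔ : Vec (Vec A l) k ↔ Vec (Vec A k) l
  transpose-↔ = mk↔ₛ′ transpose transpose transpose-involutive transpose-involutive

  Σ-transpose-↔ : (P : Vec (Vec A l) k → Set) →
                  Σ (Vec (Vec A l) k) P ↔ Σ (Vec (Vec A k) l) (P ∘ transpose)
  Σ-transpose-↔ P = Σ-↔ transpose-↔ (K-reflexive (cong P (sym (transpose-involutive _))))

  dropZeroRows-↔ : Mat k l ↔ Σ (Σ (Vec Bool k) λ R → Mat (onesRow R) l) (λ (R , N) → noZeroRows N ≡ true)
  dropZeroRows-↔ = mk↔ₛ′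
    (λ M → dropZeroRows M , noZeroRows-dropZeroRows M) (λ ((R , N) , _) → padZeroRows R N)
    (λ ((R , N) , nz) → Σ-≡-irrelevant uip (dropZeroRows-padZeroRows R N nz)) padZeroRows-dropZeroRows

  Σ-rows-↔ : (P : Mat k l → Set) →
             Σ (Mat k l) P ↔
             Σ (Vec Bool k) λ R → Σ (Mat (onesRow R) l) λ N → (noZeroRows N ≡ true) × P (padZeroRows R N)
  Σ-rows-↔ P = ↔-trans (Σ-↔ dropZeroRows-↔ (K-reflexive (cong P (sym (padZeroRows-dropZeroRows _)))))
                       (↔-trans Σ-assoc Σ-assoc)

  padZeroColumns : (S : Vec Bool l) → Mat k (onesRow S) → Mat k l
  padZeroColumns S Q = transpose (padZeroRows S (transpose Q))

  Σ-columns-↔ : (P : Mat k l → Set) →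
                Σ (Mat k l) P ↔
                Σ (Vec Bool l) λ S → Σ (Mat k (onesRow S)) λ Q →
                  (noZeroRows (transpose Q) ≡ true) × P (padZeroColumns S Q)
  Σ-columns-↔ P = ↔-trans (Σ-transpose-↔ P) (↔-trans (Σ-rows-↔ _) (Σ-congʳ (Σ-transpose-↔ _)))

  flatten-↔ : ∀ n k l → Σ (Mat k l) (λ M → ones M ≡ n) ↔ Σ (Vec Bool (k * l)) (λ v → onesRow v ≡ n)
  flatten-↔ n k l = Σ-↔ concat-↔ λ {M} → K-reflexive (cong (_≡ n) (sym (onesRow-concat M)))

  IncMatOfSize : ℕ → ℕ → ℕ → Set
  IncMatOfSize n i j = Σ (Mat i j) λ P → (isIncidence P ≡ true) × (ones P ≡ n)

  ∧-↔ : ∀ a b {X : Set} → ((b ≡ true) × (a ≡ true) × X) ↔ ((a ∧ b ≡ true) × X)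
  ∧-↔ true  true  = mk↔ₛ′ (λ (_ , _ , x) → refl , x) (λ (_ , x) → refl , refl , x)
                          (λ { (refl , _) → refl }) (λ { (refl , refl , _) → refl })
  ∧-↔ true  false = mk↔ₛ′ (λ ()) (λ ()) (λ ()) (λ ())
  ∧-↔ false b     = mk↔ₛ′ (λ ()) (λ ()) (λ ()) (λ ())

  ones-↔-IncMatOfSize : ∀ n k l → Σ (Mat k l) (λ M → ones M ≡ n) ↔
                                  Σ (Vec Bool k) λ R → Σ (Vec Bool l) λ S → IncMatOfSize n (onesRow R) (onesRow S)
  ones-↔-IncMatOfSize n k l = ↔-trans (Σ-rows-↔ _) (Σ-congʳ λ {R} →
    ↔-trans (Σ-columns-↔ _) (Σ-congʳ λ {S} → Σ-congʳ λ {Q} → unpad R S Q))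
    where
    unpad : (R : Vec Bool k) (S : Vec Bool l) (Q : Mat (onesRow R) (onesRow S)) →
            ((noZeroRows (transpose Q) ≡ true) × (noZeroRows (padZeroColumns S Q) ≡ true) ×
             (ones (padZeroRows R (padZeroColumns S Q)) ≡ n))
            ↔ ((isIncidence Q ≡ true) × (ones Q ≡ n))
    unpad R S Q = ↔-trans
      (K-reflexive (cong₂ (λ a m → (noZeroRows (transpose Q) ≡ true) × (a ≡ true) × (m ≡ n)) rows-unpad ones-unpad))
      (∧-↔ (noZeroRows Q) (noZeroRows (transpose Q)))
      where
      rows-unpad : noZeroRows (padZeroColumns S Q) ≡ noZeroRows Q
      rows-unpad = trans (noZeroColumns-padZeroRows S (transpose Q)) (cong noZeroRows (transpose-involutive Q))
      ones-unpad : ones (padZeroRows R (padZeroColumns S Q)) ≡ ones Q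
      ones-unpad = begin
        ones (padZeroRows R (padZeroColumns S Q))  ≡⟨ ones-padZeroRows R (padZeroColumns S Q) ⟩
        ones (padZeroColumns S Q)                  ≡⟨ ones-transpose (padZeroRows S (transpose Q)) ⟩
        ones (padZeroRows S (transpose Q))         ≡⟨ ones-padZeroRows S (transpose Q) ⟩
        ones (transpose Q)                         ≡⟨ ones-transpose Q ⟩
        ones Q                                     ∎
        where open ≡-Reasoning

  ¬IncMatOfSize-tall : ∀ {n i j} → n < i → ¬ IncMatOfSize n i j
  ¬IncMatOfSize-tall n<i (P , inc , refl) = <⇒≱ n<i (noZeroRows⇒rows≤ones P (∧-conicalˡ _ _ inc))

  ¬IncMatOfSize-wide : ∀ {n i j} → n < j → ¬ IncMatOfSize n i j
  ¬IncMatOfSize-wide {j = j} n<j (P , inc , refl) =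
    <⇒≱ n<j (subst (j ≤_) (ones-transpose P) (noZeroRows⇒rows≤ones (transpose P) (∧-conicalʳ _ _ inc)))

  isIncMatOfSize? : ∀ {i j} n (P : Mat i j) → Dec ((isIncidence P ≡ true) × (ones P ≡ n))
  isIncMatOfSize? n P = (isIncidence P ≟ᵇ true) ×-dec (ones P ≟ n)

  Mat-enumerable : ∀ k l → Enumerable (Mat k l)
  Mat-enumerable k l = Vec-enumerable (Vec-enumerable Bool-enumerable l) k

  incidenceCount : ℕ → ℕ → ℕ → ℕ
  incidenceCount n i j = sum (Mat-enumerable i j) (indicator ∘ isIncMatOfSize? n)

  IncMatOfSize-↔-Fin : ∀ n i j → IncMatOfSize n i j ↔ Fin (incidenceCount n i j)
  IncMatOfSize-↔-Fin n i j = Σ-↔-Fin (Mat-enumerable i j) _ λ P →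
    Dec-↔-Fin (λ (p , q) (p′ , q′) → cong₂ _,_ (uip p p′) (uip q q′)) (isIncMatOfSize? n P)

  IncMat-↔-Fin : ∀ n → IncMat n ↔ Fin (∑[ i < suc n ] ∑[ j < suc n ] incidenceCount n i j)
  IncMat-↔-Fin n = Σℕ-↔-Fin (suc n) _
    (λ i _ → Σℕ-↔-Fin (suc n) _ (λ j _ → IncMatOfSize-↔-Fin n i j) (λ j → ¬IncMatOfSize-wide))
    (λ i n<i (_ , x) → ¬IncMatOfSize-tall n<i x)

  Σ-IncMatOfSize-↔-Fin : ∀ n l i → Σ (Vec Bool l) (IncMatOfSize n i ∘ onesRow) ↔
                              Fin (∑[ j < suc n ] ((l C j) * incidenceCount n i j))
  Σ-IncMatOfSize-↔-Fin n l i =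
    Σ-onesRow-↔-Fin l (suc n) _ (λ j _ → IncMatOfSize-↔-Fin n i j) (λ j → ¬IncMatOfSize-wide)

  binomial-expansion : ∀ n k l →
    (k * l) C n ≡ ∑[ i < suc n ] ((k C i) * ∑[ j < suc n ] ((l C j) * incidenceCount n i j))
  binomial-expansion n k l = ↔⇒≡ (begin
    Fin ((k * l) C n)                              ↔⟨ binomial-↔ (k * l) n ⟨
    Σ (Vec Bool (k * l)) (λ v → onesRow v ≡ n)     ↔⟨ flatten-↔ n k l ⟨
    Σ (Mat k l) (λ M → ones M ≡ n)                 ↔⟨ ones-↔-IncMatOfSize n k l ⟩
    Σ (Vec Bool k) (λ R → Σ (Vec Bool l) λ S → IncMatOfSize n (onesRow R) (onesRow S))
      ↔⟨ Σ-onesRow-↔-Fin k (suc n) {λ i → Σ (Vec Bool l) (IncMatOfSize n i ∘ onesRow)} _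
                         (λ i _ → Σ-IncMatOfSize-↔-Fin n l i) (λ i n<i (_ , x) → ¬IncMatOfSize-tall n<i x) ⟩
    Fin (∑[ i < suc n ] ((k C i) * ∑[ j < suc n ] ((l C j) * incidenceCount n i j))) ∎)
    where open EquationalReasoning

module BinomialSums where

  open import Algebra.Properties.CommutativeSemigroup using (x∙yz≈y∙xz)
  open import Data.Nat using (zero; suc; _+_; _*_; _^_; _∸_; _≤_; _<_; s≤s)
  open import Data.Nat.Combinatorics using (_C_; nCk+nC[k+1]≡[n+1]C[k+1])
  open import Data.Nat.Properties
  open import Data.Nat.Solver using (module +-*-Solver)
  open import Relation.Binary.PropositionalEquality
  open +-*-Solver using (solve; _:+_; _:*_; _:=_; con)

  open FiniteSums

  product-defect : ∀ a b s t {q} → a + s ≡ q → b + t ≡ q → q * q ≤ a * b + q * (s + t)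
  product-defect a b s t {q} a+s≡q b+t≡q = begin
    q * q                  ≡⟨ cong (_* q) a+s≡q ⟨
    (a + s) * q            ≡⟨ *-distribʳ-+ q a s ⟩
    a * q + s * q          ≡⟨ cong (λ x → a * x + s * q) b+t≡q ⟨
    a * (b + t) + s * q    ≡⟨ cong (_+ s * q) (*-distribˡ-+ a b t) ⟩
    a * b + a * t + s * q  ≤⟨ +-monoˡ-≤ (s * q) (+-monoʳ-≤ (a * b) (*-monoˡ-≤ t a≤q)) ⟩
    a * b + q * t + s * q  ≡⟨ solve 4 (λ x q s t → x :+ q :* t :+ s :* q := x :+ q :* (s :+ t))
                                      refl (a * b) q s t ⟩
    a * b + q * (s + t)    ∎
    where
    open ≤-Reasoning
    a≤q : a ≤ q
    a≤q = subst (a ≤_) a+s≡q (m≤m+n a s)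

  -- 2 ^ K / 2 ^ (k + 1) for k < K, the only case in which it is used.
  weight : ℕ → ℕ → ℕ
  weight K k = 2 ^ (K ∸ suc k)

  ∸-suc : ∀ {K k} → k < K → K ∸ k ≡ suc (K ∸ suc k)
  ∸-suc {suc K} {zero}  _         = refl
  ∸-suc {suc K} {suc k} (s≤s k<K) = ∸-suc k<K

  weight-suc : ∀ {K k} → k < K → weight (suc K) k ≡ 2 * weight K k
  weight-suc k<K = cong (2 ^_) (∸-suc k<K)

  2^≡2^[1+k]*weight : ∀ {K k} → k < K → 2 ^ K ≡ 2 ^ suc k * weight K k
  2^≡2^[1+k]*weight {K} {k} k<K =
    trans (cong (2 ^_) (sym (m+[n∸m]≡n k<K))) (^-distribˡ-+-* 2 (suc k) (K ∸ suc k))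

  columnSum : ℕ → ℕ → ℕ
  columnSum i K = ∑[ k < K ] ((k C i) * weight K k)

  rowPrefix : ℕ → ℕ → ℕ
  rowPrefix i K = ∑[ j < suc i ] (K C j)

  columnSum-suc : ∀ i K → columnSum i (suc K) ≡ 2 * columnSum i K + K C i
  columnSum-suc i K = cong₂ _+_ doubled last
    where
    doubled : ∑[ k < K ] ((k C i) * weight (suc K) k) ≡ 2 * columnSum i K
    doubled = trans (∑-cong K λ k k<K → trans (cong ((k C i) *_) (weight-suc k<K))
                                              (x∙yz≈y∙xz *-commutativeSemigroup (k C i) 2 (weight K k)))
                    (sym (*-distribˡ-∑ K 2 _))
    last : (K C i) * 2 ^ (K ∸ K) ≡ K C i
    last = trans (cong (λ e → (K C i) * 2 ^ e) (n∸n≡0 K)) (*-identityʳ (K C i))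

  rowPrefix-zero : ∀ i → rowPrefix i 0 ≡ 1
  rowPrefix-zero i = trans (∑-cons i (0 C_)) (cong suc (trans (∑-const i 0) (*-zeroʳ i)))

  rowPrefix-suc : ∀ i K → rowPrefix i (suc K) + K C i ≡ 2 * rowPrefix i K
  rowPrefix-suc zero    K = refl
  rowPrefix-suc (suc i) K = begin
    rowPrefix i (suc K) + suc K C suc i + K C suc i
      ≡⟨ cong (λ c → rowPrefix i (suc K) + c + K C suc i) (nCk+nC[k+1]≡[n+1]C[k+1] K i) ⟨
    rowPrefix i (suc K) + (K C i + K C suc i) + K C suc i
      ≡⟨ solve 3 (λ s a b → s :+ (a :+ b) :+ b := s :+ a :+ con 2 :* b)
                 refl (rowPrefix i (suc K)) (K C i) (K C suc i) ⟩
    rowPrefix i (suc K) + K C i + 2 * (K C suc i)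
      ≡⟨ cong (_+ 2 * (K C suc i)) (rowPrefix-suc i K) ⟩
    2 * rowPrefix i K + 2 * (K C suc i)
      ≡⟨ *-distribˡ-+ 2 (rowPrefix i K) (K C suc i) ⟨
    2 * rowPrefix (suc i) K ∎
    where open ≡-Reasoning

  columnSum+rowPrefix : ∀ i K → columnSum i K + rowPrefix i K ≡ 2 ^ K
  columnSum+rowPrefix i zero    = rowPrefix-zero i
  columnSum+rowPrefix i (suc K) = begin
    columnSum i (suc K) + rowPrefix i (suc K)          ≡⟨ cong (_+ rowPrefix i (suc K)) (columnSum-suc i K) ⟩
    2 * columnSum i K + K C i + rowPrefix i (suc K)    ≡⟨ solve 3 (λ a c s → con 2 :* a :+ c :+ s :=
                                                                              con 2 :* a :+ (s :+ c))
                                                             refl (columnSum i K) (K C i) (rowPrefix i (suc K)) ⟩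
    2 * columnSum i K + (rowPrefix i (suc K) + K C i)  ≡⟨ cong (2 * columnSum i K +_) (rowPrefix-suc i K) ⟩
    2 * columnSum i K + 2 * rowPrefix i K              ≡⟨ *-distribˡ-+ 2 (columnSum i K) (rowPrefix i K) ⟨
    2 * (columnSum i K + rowPrefix i K)                ≡⟨ cong (2 *_) (columnSum+rowPrefix i K) ⟩
    2 ^ suc K                                          ∎
    where open ≡-Reasoning

  columnSum≤2^ : ∀ i K → columnSum i K ≤ 2 ^ K
  columnSum≤2^ i K = subst (columnSum i K ≤_) (columnSum+rowPrefix i K) (m≤m+n _ _)

  rowPrefix-mono : ∀ {i d} K → i ≤ d → rowPrefix i K ≤ rowPrefix d K
  rowPrefix-mono K i≤d = ∑-mono-range (K C_) (s≤s i≤d)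

  rowPrefix-doubling : ∀ i m K → rowPrefix i (m + K) ≤ 2 ^ m * rowPrefix i K
  rowPrefix-doubling i zero    K = ≤-reflexive (sym (*-identityˡ (rowPrefix i K)))
  rowPrefix-doubling i (suc m) K = begin
    rowPrefix i (suc (m + K))
      ≤⟨ subst (rowPrefix i (suc (m + K)) ≤_) (rowPrefix-suc i (m + K)) (m≤m+n _ _) ⟩
    2 * rowPrefix i (m + K)      ≤⟨ *-monoʳ-≤ 2 (rowPrefix-doubling i m K) ⟩
    2 * (2 ^ m * rowPrefix i K)  ≡⟨ *-assoc 2 (2 ^ m) (rowPrefix i K) ⟨
    2 ^ suc m * rowPrefix i K    ∎
    where open ≤-Reasoning

  rowPrefix≤2*weight* : ∀ i {K k} → k < K → rowPrefix i K ≤ 2 * (weight K k * rowPrefix i k)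
  rowPrefix≤2*weight* i {K} {k} k<K = begin
    rowPrefix i K                     ≡⟨ cong (rowPrefix i) (m∸n+n≡m (<⇒≤ k<K)) ⟨
    rowPrefix i (K ∸ k + k)           ≤⟨ rowPrefix-doubling i (K ∸ k) k ⟩
    2 ^ (K ∸ k) * rowPrefix i k       ≡⟨ cong (λ e → 2 ^ e * rowPrefix i k) (∸-suc k<K) ⟩
    2 * weight K k * rowPrefix i k    ≡⟨ *-assoc 2 (weight K k) (rowPrefix i k) ⟩
    2 * (weight K k * rowPrefix i k)  ∎
    where open ≤-Reasoning

  -- Summing rowPrefix≤2*weight* over k < K regroups the right-hand sides into column sums.
  rowPrefix-decay : ∀ d K → K * rowPrefix d K ≤ 2 * (suc d * 2 ^ K)
  rowPrefix-decay d K = begin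
    K * rowPrefix d K                                      ≡⟨ ∑-const K (rowPrefix d K) ⟨
    ∑[ k < K ] rowPrefix d K                               ≤⟨ ∑-mono-≤ K (λ k → rowPrefix≤2*weight* d) ⟩
    ∑[ k < K ] (2 * (weight K k * rowPrefix d k))          ≡⟨ *-distribˡ-∑ K 2 _ ⟨
    2 * ∑[ k < K ] (weight K k * rowPrefix d k)            ≡⟨ cong (2 *_) (∑-cong K λ k _ → expand k) ⟩
    2 * ∑[ k < K ] ∑[ j < suc d ] ((k C j) * weight K k)   ≡⟨ cong (2 *_) (∑-comm K (suc d) _) ⟩
    2 * ∑[ j < suc d ] columnSum j K                       ≤⟨ *-monoʳ-≤ 2 (∑-mono-≤ (suc d) λ j _ →
                                                                columnSum≤2^ j K) ⟩
    2 * ∑[ j < suc d ] (2 ^ K)                             ≡⟨ cong (2 *_) (∑-const (suc d) (2 ^ K)) ⟩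
    2 * (suc d * 2 ^ K)                                    ∎
    where
    open ≤-Reasoning
    expand : ∀ k → weight K k * rowPrefix d k ≡ ∑[ j < suc d ] ((k C j) * weight K k)
    expand k = trans (*-distribˡ-∑ (suc d) (weight K k) _)
                     (∑-cong (suc d) λ j _ → *-comm (weight K k) (k C j))

module BinomialTransform (d : ℕ) (G : ℕ → ℕ → ℕ) where

  open import Data.Nat using (suc; _+_; _*_; _^_; _≤_)
  open import Data.Nat.Combinatorics using (_C_)
  open import Data.Nat.Properties
  open import Data.Nat.Solver using (module +-*-Solver)
  open import Relation.Binary.PropositionalEquality
  open +-*-Solver using (solve; _:+_; _:*_; _:=_; con)

  open FiniteSums
  open BinomialSums

  expansion : ℕ → ℕ → ℕ
  expansion k l = ∑[ i < suc d ] ((k C i) * ∑[ j < suc d ] ((l C j) * G i j))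

  total : ℕ
  total = ∑[ i < suc d ] ∑[ j < suc d ] G i j

  scaledSum : ℕ → ℕ
  scaledSum K = ∑[ k < K ] ∑[ l < K ] (expansion k l * (weight K k * weight K l))

  total*≡∑∑ : ∀ c → total * c ≡ ∑[ i < suc d ] ∑[ j < suc d ] (G i j * c)
  total*≡∑∑ c = trans (*-distribʳ-∑ (suc d) c _) (∑-cong (suc d) λ i _ → *-distribʳ-∑ (suc d) c (G i))

  scaledSum≡ : ∀ K → scaledSum K ≡ ∑[ i < suc d ] ∑[ j < suc d ] (G i j * (columnSum i K * columnSum j K))
  scaledSum≡ K = begin
    scaledSum K
      ≡⟨ ∑-cong K (λ k _ → ∑-cong K λ l _ → expansion-weighted k l) ⟩
    ∑[ k < K ] ∑[ l < K ] ∑[ i < suc d ] ∑[ j < suc d ] h k l i j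
      ≡⟨ ∑∑-comm K K (suc d) (suc d) h ⟩
    ∑[ i < suc d ] ∑[ j < suc d ] ∑[ k < K ] ∑[ l < K ] h k l i j
      ≡⟨ ∑-cong (suc d) (λ i _ → ∑-cong (suc d) λ j _ → ∑∑-product K K (G i j) _ _) ⟩
    ∑[ i < suc d ] ∑[ j < suc d ] (G i j * (columnSum i K * columnSum j K)) ∎
    where
    open ≡-Reasoning
    h : ℕ → ℕ → ℕ → ℕ → ℕ
    h k l i j = G i j * (((k C i) * weight K k) * ((l C j) * weight K l))
    expansion-weighted : ∀ k l →
                         expansion k l * (weight K k * weight K l) ≡ ∑[ i < suc d ] ∑[ j < suc d ] h k l i j
    expansion-weighted k l = trans (*-distribʳ-∑ (suc d) w _) (∑-cong (suc d) λ i _ → begin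
      (k C i) * ∑[ j < suc d ] ((l C j) * G i j) * w    ≡⟨ cong (_* w) (*-distribˡ-∑ (suc d) (k C i) _) ⟩
      ∑[ j < suc d ] ((k C i) * ((l C j) * G i j)) * w  ≡⟨ *-distribʳ-∑ (suc d) w _ ⟩
      ∑[ j < suc d ] ((k C i) * ((l C j) * G i j) * w)  ≡⟨ ∑-cong (suc d) (λ j _ →
                                                             regroup (k C i) (l C j) (G i j)) ⟩
      ∑[ j < suc d ] h k l i j                          ∎)
      where
      w : ℕ
      w = weight K k * weight K l
      regroup : ∀ a b g → a * (b * g) * w ≡ g * ((a * weight K k) * (b * weight K l))
      regroup a b g = solve 5 (λ a b g x y → a :* (b :* g) :* (x :* y) := g :* ((a :* x) :* (b :* y)))
                              refl a b g (weight K k) (weight K l)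

  scaledSum≤ : ∀ K → scaledSum K ≤ total * (2 ^ K * 2 ^ K)
  scaledSum≤ K = begin
    scaledSum K                                                              ≡⟨ scaledSum≡ K ⟩
    ∑[ i < suc d ] ∑[ j < suc d ] (G i j * (columnSum i K * columnSum j K))
      ≤⟨ ∑-mono-≤ (suc d) (λ i _ → ∑-mono-≤ (suc d) λ j _ →
           *-monoʳ-≤ (G i j) (*-mono-≤ (columnSum≤2^ i K) (columnSum≤2^ j K))) ⟩
    ∑[ i < suc d ] ∑[ j < suc d ] (G i j * (2 ^ K * 2 ^ K))                   ≡⟨ total*≡∑∑ _ ⟨
    total * (2 ^ K * 2 ^ K)                                                  ∎
    where open ≤-Reasoning

  total*4^≤ : ∀ K → total * (2 ^ K * 2 ^ K) ≤ scaledSum K + total * (2 ^ K * (rowPrefix d K + rowPrefix d K))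
  total*4^≤ K = begin
    total * (2 ^ K * 2 ^ K)                                 ≡⟨ total*≡∑∑ _ ⟩
    ∑[ i < suc d ] ∑[ j < suc d ] (G i j * (2 ^ K * 2 ^ K))
      ≤⟨ ∑-mono-≤ (suc d) (λ i i≤d → ∑-mono-≤ (suc d) λ j j≤d →
           ≤-trans (*-monoʳ-≤ (G i j) (defect (≤-pred i≤d) (≤-pred j≤d)))
                   (≤-reflexive (*-distribˡ-+ (G i j) _ B))) ⟩
    ∑[ i < suc d ] ∑[ j < suc d ] (G i j * (columnSum i K * columnSum j K) + G i j * B)
      ≡⟨ trans (∑-cong (suc d) λ i _ → ∑-distrib-+ (suc d) _ _) (∑-distrib-+ (suc d) _ _) ⟩
    ∑[ i < suc d ] ∑[ j < suc d ] (G i j * (columnSum i K * columnSum j K)) +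
    ∑[ i < suc d ] ∑[ j < suc d ] (G i j * B)
      ≡⟨ cong₂ _+_ (scaledSum≡ K) (total*≡∑∑ B) ⟨
    scaledSum K + total * B                                 ∎
    where
    open ≤-Reasoning
    B : ℕ
    B = 2 ^ K * (rowPrefix d K + rowPrefix d K)
    defect : ∀ {i j} → i ≤ d → j ≤ d → 2 ^ K * 2 ^ K ≤ columnSum i K * columnSum j K + B
    defect {i} {j} i≤d j≤d =
      ≤-trans (product-defect (columnSum i K) (columnSum j K) (rowPrefix i K) (rowPrefix j K)
                              (columnSum+rowPrefix i K) (columnSum+rowPrefix j K))
              (+-monoʳ-≤ _ (*-monoʳ-≤ (2 ^ K) (+-mono-≤ (rowPrefix-mono K i≤d) (rowPrefix-mono K j≤d))))

  error-bound : ∀ K → K * (total * (2 ^ K * 2 ^ K)) ≤ K * scaledSum K + total * (4 * suc d) * (2 ^ K * 2 ^ K)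
  error-bound K = begin
    K * (total * (2 ^ K * 2 ^ K))
      ≤⟨ *-monoʳ-≤ K (total*4^≤ K) ⟩
    K * (scaledSum K + total * (2 ^ K * (S + S)))
      ≡⟨ solve 5 (λ k x f p s → k :* (x :+ f :* (p :* (s :+ s))) := k :* x :+ f :* p :* con 2 :* (k :* s))
                 refl K (scaledSum K) total (2 ^ K) S ⟩
    K * scaledSum K + total * 2 ^ K * 2 * (K * S)
      ≤⟨ +-monoʳ-≤ (K * scaledSum K) (*-monoʳ-≤ (total * 2 ^ K * 2) (rowPrefix-decay d K)) ⟩
    K * scaledSum K + total * 2 ^ K * 2 * (2 * (suc d * 2 ^ K))
      ≡⟨ solve 5 (λ k x f p n → k :* x :+ f :* p :* con 2 :* (con 2 :* (n :* p)) :=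
                                 k :* x :+ f :* (con 4 :* n) :* (p :* p))
                 refl K (scaledSum K) total (2 ^ K) (suc d) ⟩
    K * scaledSum K + total * (4 * suc d) * (2 ^ K * 2 ^ K) ∎
    where
    open ≤-Reasoning
    S : ℕ
    S = rowPrefix d K

module Limits where

  open import Data.Integer as ℤ using (+_; +[1+_]; -[1+_])
  import Data.Integer.Properties as ℤ
  open import Data.Nat as ℕ using (zero; suc; _^_)
  import Data.Nat.Properties as ℕ
  open import Data.Nat.Combinatorics using (_C_)
  open import Data.Product using (Σ; _,_)
  open import Data.Rational
  open import Data.Rational.Properties
  open import Data.Rational.Solver using (module +-*-Solver)
  import Data.Rational.Unnormalised as ℚᵘ
  import Data.Rational.Unnormalised.Properties as ℚᵘ
  open import Function using (_∘_)
  open import Relation.Binary.PropositionalEquality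
  open +-*-Solver using (solve; _:+_; _:-_; :-_; _:*_; _:=_)

  open FiniteSums
  open BinomialSums using (weight; 2^≡2^[1+k]*weight)

  toℚ : ℕ → ℚ
  toℚ n = + n / 1

  toℚᵘ-toℚ : ∀ n → toℚᵘ (toℚ n) ℚᵘ.≃ ℚᵘ.mkℚᵘ (+ n) 0
  toℚᵘ-toℚ n = toℚᵘ-fromℚᵘ (ℚᵘ.mkℚᵘ (+ n) 0)

  toℚ-+ : ∀ m n → toℚ (m ℕ.+ n) ≡ toℚ m + toℚ n
  toℚ-+ m n = toℚᵘ-injective (begin-equality
    toℚᵘ (toℚ (m ℕ.+ n))                  ≃⟨ toℚᵘ-toℚ (m ℕ.+ n) ⟩
    ℚᵘ.mkℚᵘ (+ (m ℕ.+ n)) 0               ≃⟨ ℚᵘ.*≡* (cong (ℤ._* + 1) (trans (ℤ.pos-+ m n)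
                                               (sym (cong₂ ℤ._+_ (ℤ.*-identityʳ (+ m)) (ℤ.*-identityʳ (+ n)))))) ⟩
    ℚᵘ.mkℚᵘ (+ m) 0 ℚᵘ.+ ℚᵘ.mkℚᵘ (+ n) 0  ≃⟨ ℚᵘ.+-cong (toℚᵘ-toℚ m) (toℚᵘ-toℚ n) ⟨
    toℚᵘ (toℚ m) ℚᵘ.+ toℚᵘ (toℚ n)        ≃⟨ toℚᵘ-homo-+ (toℚ m) (toℚ n) ⟨
    toℚᵘ (toℚ m + toℚ n)                  ∎)
    where open ℚᵘ.≤-Reasoning

  toℚ-* : ∀ m n → toℚ (m ℕ.* n) ≡ toℚ m * toℚ n
  toℚ-* m n = toℚᵘ-injective (begin-equality
    toℚᵘ (toℚ (m ℕ.* n))                  ≃⟨ toℚᵘ-toℚ (m ℕ.* n) ⟩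
    ℚᵘ.mkℚᵘ (+ (m ℕ.* n)) 0               ≃⟨ ℚᵘ.*≡* (cong (ℤ._* + 1) (ℤ.pos-* m n)) ⟩
    ℚᵘ.mkℚᵘ (+ m) 0 ℚᵘ.* ℚᵘ.mkℚᵘ (+ n) 0  ≃⟨ ℚᵘ.*-cong (toℚᵘ-toℚ m) (toℚᵘ-toℚ n) ⟨
    toℚᵘ (toℚ m) ℚᵘ.* toℚᵘ (toℚ n)        ≃⟨ toℚᵘ-homo-* (toℚ m) (toℚ n) ⟨
    toℚᵘ (toℚ m * toℚ n)                  ∎)
    where open ℚᵘ.≤-Reasoning

  toℚ-mono-≤ : ∀ {m n} → m ℕ.≤ n → toℚ m ≤ toℚ n
  toℚ-mono-≤ {m} {n} m≤n = toℚᵘ-cancel-≤ (begin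
    toℚᵘ (toℚ m)     ≃⟨ toℚᵘ-toℚ m ⟩
    ℚᵘ.mkℚᵘ (+ m) 0  ≤⟨ ℚᵘ.*≤* (ℤ.*-monoʳ-≤-nonNeg (+ 1) (ℤ.+≤+ m≤n)) ⟩
    ℚᵘ.mkℚᵘ (+ n) 0  ≃⟨ toℚᵘ-toℚ n ⟨
    toℚᵘ (toℚ n)     ∎)
    where open ℚᵘ.≤-Reasoning

  toℚ-nonNeg : ∀ n → NonNegative (toℚ n)
  toℚ-nonNeg n = normalize-nonNeg n 1

  toℚ-pos : ∀ {n} → 0 ℕ.< n → Positive (toℚ n)
  toℚ-pos {suc n} _ = normalize-pos (suc n) 1

  toℚ-∑ : ∀ K (f : ℕ → ℕ) → toℚ (∑< K f) ≡ sumTo K (toℚ ∘ f)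
  toℚ-∑ zero    f = refl
  toℚ-∑ (suc K) f = trans (toℚ-+ (∑< K f) (f K)) (cong (_+ toℚ (f K)) (toℚ-∑ K f))

  sumTo-cong : ∀ K {f g : ℕ → ℚ} → (∀ k → k ℕ.< K → f k ≡ g k) → sumTo K f ≡ sumTo K g
  sumTo-cong zero    f≗g = refl
  sumTo-cong (suc K) f≗g =
    cong₂ _+_ (sumTo-cong K λ k k<K → f≗g k (ℕ.m<n⇒m<1+n k<K)) (f≗g K ℕ.≤-refl)

  *-distribʳ-sumTo : ∀ K c (f : ℕ → ℚ) → sumTo K f * c ≡ sumTo K (λ k → f k * c)
  *-distribʳ-sumTo zero    c f = *-zeroˡ c
  *-distribʳ-sumTo (suc K) c f =
    trans (*-distribʳ-+ c (sumTo K f) (f K)) (cong (_+ f K * c) (*-distribʳ-sumTo K c f))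

  halfPow-+ : ∀ a b → halfPow (a ℕ.+ b) ≡ halfPow a * halfPow b
  halfPow-+ zero    b = sym (*-identityˡ (halfPow b))
  halfPow-+ (suc a) b = trans (cong (½ *_) (halfPow-+ a b)) (sym (*-assoc ½ (halfPow a) (halfPow b)))

  halfPow*2^ : ∀ e → halfPow e * toℚ (2 ^ e) ≡ 1ℚ
  halfPow*2^ zero    = refl
  halfPow*2^ (suc e) = begin
    ½ * halfPow e * toℚ (2 ℕ.* 2 ^ e)      ≡⟨ cong (½ * halfPow e *_) (toℚ-* 2 (2 ^ e)) ⟩
    ½ * halfPow e * (toℚ 2 * toℚ (2 ^ e))  ≡⟨ solve 4 (λ h p t e → (h :* p) :* (t :* e) := (h :* t) :* (p :* e))
                                                   refl ½ (halfPow e) (toℚ 2) (toℚ (2 ^ e)) ⟩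
    ½ * toℚ 2 * (halfPow e * toℚ (2 ^ e))  ≡⟨ cong (½ * toℚ 2 *_) (halfPow*2^ e) ⟩
    1ℚ                                     ∎
    where open ≡-Reasoning

  weighted-term : ∀ c {K k l} → k ℕ.< K → l ℕ.< K →
                  toℚ c * halfPow (k ℕ.+ l ℕ.+ 2) * toℚ (2 ^ K ℕ.* 2 ^ K) ≡
                  toℚ (c ℕ.* (weight K k ℕ.* weight K l))
  weighted-term c {K} {k} {l} k<K l<K = begin
    toℚ c * halfPow (k ℕ.+ l ℕ.+ 2) * toℚ (2 ^ K ℕ.* 2 ^ K)
      ≡⟨ cong₂ (λ h q → toℚ c * h * toℚ q)
               (trans (cong halfPow k+l+2≡1+k+1+l) (halfPow-+ (suc k) (suc l)))
               (cong₂ ℕ._*_ (2^≡2^[1+k]*weight k<K) (2^≡2^[1+k]*weight l<K)) ⟩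
    toℚ c * (h₁ * h₂) * toℚ ((2 ^ suc k ℕ.* wₖ) ℕ.* (2 ^ suc l ℕ.* wₗ))
      ≡⟨ cong (toℚ c * (h₁ * h₂) *_) (trans (toℚ-* (2 ^ suc k ℕ.* wₖ) (2 ^ suc l ℕ.* wₗ))
                                            (cong₂ _*_ (toℚ-* (2 ^ suc k) wₖ) (toℚ-* (2 ^ suc l) wₗ))) ⟩
    toℚ c * (h₁ * h₂) * ((toℚ (2 ^ suc k) * toℚ wₖ) * (toℚ (2 ^ suc l) * toℚ wₗ))
      ≡⟨ solve 7 (λ c h₁ h₂ p₁ w₁ p₂ w₂ → c :* (h₁ :* h₂) :* ((p₁ :* w₁) :* (p₂ :* w₂)) :=
                                           c :* (w₁ :* w₂) :* ((h₁ :* p₁) :* (h₂ :* p₂)))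
                 refl (toℚ c) h₁ h₂ (toℚ (2 ^ suc k)) (toℚ wₖ) (toℚ (2 ^ suc l)) (toℚ wₗ) ⟩
    toℚ c * (toℚ wₖ * toℚ wₗ) * ((h₁ * toℚ (2 ^ suc k)) * (h₂ * toℚ (2 ^ suc l)))
      ≡⟨ cong₂ (λ a b → toℚ c * (toℚ wₖ * toℚ wₗ) * (a * b)) (halfPow*2^ (suc k)) (halfPow*2^ (suc l)) ⟩
    toℚ c * (toℚ wₖ * toℚ wₗ) * 1ℚ
      ≡⟨ *-identityʳ _ ⟩
    toℚ c * (toℚ wₖ * toℚ wₗ)
      ≡⟨ trans (toℚ-* c (wₖ ℕ.* wₗ)) (cong (toℚ c *_) (toℚ-* wₖ wₗ)) ⟨
    toℚ (c ℕ.* (wₖ ℕ.* wₗ)) ∎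
    where
    open ≡-Reasoning
    h₁ h₂ : ℚ
    h₁ = halfPow (suc k)
    h₂ = halfPow (suc l)
    wₖ wₗ : ℕ
    wₖ = weight K k
    wₗ = weight K l
    k+l+2≡1+k+1+l : k ℕ.+ l ℕ.+ 2 ≡ suc k ℕ.+ suc l
    k+l+2≡1+k+1+l = trans (ℕ.+-assoc k l 2) (trans (cong (k ℕ.+_) (ℕ.+-comm l 2)) (ℕ.+-suc k (suc l)))

  partial*4^ : ∀ n K → partial n K * toℚ (2 ^ K ℕ.* 2 ^ K) ≡
                       toℚ (∑[ k < K ] ∑[ l < K ] (((k ℕ.* l) C n) ℕ.* (weight K k ℕ.* weight K l)))
  partial*4^ n K = begin
    partial n K * q
      ≡⟨ *-distribʳ-sumTo K q _ ⟩
    sumTo K (λ k → sumTo K (term n k) * q)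
      ≡⟨ sumTo-cong K (λ k k<K → trans (*-distribʳ-sumTo K q _) (sumTo-cong K λ l l<K →
                                   weighted-term ((k ℕ.* l) C n) k<K l<K)) ⟩
    sumTo K (λ k → sumTo K λ l → toℚ (((k ℕ.* l) C n) ℕ.* (weight K k ℕ.* weight K l)))
      ≡⟨ trans (toℚ-∑ K _) (sumTo-cong K λ k _ → toℚ-∑ K _) ⟨
    toℚ (∑[ k < K ] ∑[ l < K ] (((k ℕ.* l) C n) ℕ.* (weight K k ℕ.* weight K l))) ∎
    where
    open ≡-Reasoning
    q : ℚ
    q = toℚ (2 ^ K ℕ.* 2 ^ K)

  archimedean : ∀ c {K} (ε : ℚ) → 0ℚ < ε → suc (c ℕ.* ↧ₙ ε) ℕ.≤ K → toℚ c < toℚ K * ε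
  archimedean c {K} ε@(mkℚ +[1+ p ] q-1 _) _ c*q<K = toℚᵘ-cancel-< (begin-strict
    toℚᵘ (toℚ c)                 ≃⟨ toℚᵘ-toℚ c ⟩
    ℚᵘ.mkℚᵘ (+ c) 0              <⟨ ℚᵘ.*<* cross ⟩
    ℚᵘ.mkℚᵘ (+ K) 0 ℚᵘ.* toℚᵘ ε  ≃⟨ ℚᵘ.*-cong (toℚᵘ-toℚ K) (ℚᵘ.≃-refl {toℚᵘ ε}) ⟨
    toℚᵘ (toℚ K) ℚᵘ.* toℚᵘ ε     ≃⟨ toℚᵘ-homo-* (toℚ K) ε ⟨
    toℚᵘ (toℚ K * ε)             ∎)
    where
    open ℚᵘ.≤-Reasoning
    cross : + c ℤ.* + (1 ℕ.* suc q-1) ℤ.< + K ℤ.* +[1+ p ] ℤ.* + 1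
    cross = subst₂ ℤ._<_ (ℤ.pos-* c (1 ℕ.* suc q-1))
                         (trans (ℤ.pos-* (K ℕ.* suc p) 1) (cong (ℤ._* + 1) (ℤ.pos-* K (suc p))))
                         (ℤ.+<+ (subst₂ ℕ._<_ (cong (c ℕ.*_) (sym (ℕ.*-identityˡ (suc q-1))))
                                              (sym (ℕ.*-identityʳ (K ℕ.* suc p)))
                                              (ℕ.<-≤-trans c*q<K (ℕ.m≤m*n K (suc p)))))
  archimedean c (mkℚ (+ 0)    _ _) (*<* (ℤ.+<+ ()))
  archimedean c (mkℚ -[1+ _ ] _ _) (*<* ())

  ∣p-q∣≡q-p : ∀ {p q} → p ≤ q → ∣ p - q ∣ ≡ q - p
  ∣p-q∣≡q-p {p} {q} p≤q = begin
    ∣ p - q ∣      ≡⟨ cong ∣_∣ (solve 2 (λ p q → p :- q := :- (q :- p)) refl p q) ⟩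
    ∣ - (q - p) ∣  ≡⟨ ∣-p∣≡∣p∣ (q - p) ⟩
    ∣ q - p ∣      ≡⟨ 0≤p⇒∣p∣≡p (subst (_≤ q - p) (+-inverseʳ p) (+-monoˡ-≤ (- p) p≤q)) ⟩
    q - p          ∎
    where open ≡-Reasoning

  converges-of-error-bound : (f : ℚ) (c : ℕ) (P : ℕ → ℚ) →
                             (∀ K → P K ≤ f) → (∀ K → toℚ K * (f - P K) ≤ toℚ c) →
                             ∀ ε → 0ℚ < ε → Σ ℕ λ N → ∀ K → N ℕ.≤ K → ∣ P K - f ∣ < ε
  converges-of-error-bound f c P P≤f error≤c ε ε>0 = suc (c ℕ.* ↧ₙ ε) , λ K N≤K →
    subst (_< ε) (sym (∣p-q∣≡q-p (P≤f K)))
          (*-cancelˡ-<-nonNeg (toℚ K) {{toℚ-nonNeg K}} (≤-<-trans (error≤c K) (archimedean c ε ε>0 N≤K)))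

  scaled-≤ : ∀ {p} x f q → 0 ℕ.< q → p * toℚ q ≡ toℚ x → x ℕ.≤ f ℕ.* q → p ≤ toℚ f
  scaled-≤ {p} x f q q>0 p*q≡x x≤f*q = *-cancelʳ-≤-pos (toℚ q) {{toℚ-pos q>0}} (begin
    p * toℚ q      ≡⟨ p*q≡x ⟩
    toℚ x          ≤⟨ toℚ-mono-≤ x≤f*q ⟩
    toℚ (f ℕ.* q)  ≡⟨ toℚ-* f q ⟩
    toℚ f * toℚ q  ∎)
    where open ≤-Reasoning

  scaled-error : ∀ {p} x f q c K → 0 ℕ.< q → p * toℚ q ≡ toℚ x →
                 K ℕ.* (f ℕ.* q) ℕ.≤ K ℕ.* x ℕ.+ c ℕ.* q → toℚ K * (toℚ f - p) ≤ toℚ c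
  scaled-error {p} x f q c K q>0 p*q≡x bound = *-cancelʳ-≤-pos (toℚ q) {{toℚ-pos q>0}} (begin
    toℚ K * (toℚ f - p) * toℚ q
      ≡⟨ solve 4 (λ k f p q → k :* (f :- p) :* q := k :* (f :* q) :- k :* (p :* q))
                 refl (toℚ K) (toℚ f) p (toℚ q) ⟩
    toℚ K * (toℚ f * toℚ q) - toℚ K * (p * toℚ q)
      ≤⟨ +-monoˡ-≤ (- (toℚ K * (p * toℚ q))) lifted ⟩
    toℚ K * (p * toℚ q) + toℚ c * toℚ q - toℚ K * (p * toℚ q)
      ≡⟨ solve 2 (λ a b → a :+ b :- a := b) refl (toℚ K * (p * toℚ q)) (toℚ c * toℚ q) ⟩
    toℚ c * toℚ q ∎)
    where
    open ≤-Reasoning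
    lifted : toℚ K * (toℚ f * toℚ q) ≤ toℚ K * (p * toℚ q) + toℚ c * toℚ q
    lifted = subst₂ _≤_ (trans (toℚ-* K (f ℕ.* q)) (cong (toℚ K *_) (toℚ-* f q)))
                        (trans (toℚ-+ (K ℕ.* x) (c ℕ.* q))
                               (cong₂ _+_ (trans (toℚ-* K x) (cong (toℚ K *_) (sym p*q≡x))) (toℚ-* c q)))
                        (toℚ-mono-≤ bound)

  converges-of-scaled-bounds : (f c : ℕ) (P : ℕ → ℚ) (X Q : ℕ → ℕ) → (∀ K → 0 ℕ.< Q K) →
    (∀ K → P K * toℚ (Q K) ≡ toℚ (X K)) → (∀ K → X K ℕ.≤ f ℕ.* Q K) →
    (∀ K → K ℕ.* (f ℕ.* Q K) ℕ.≤ K ℕ.* X K ℕ.+ c ℕ.* Q K) →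
    ∀ ε → 0ℚ < ε → Σ ℕ λ N → ∀ K → N ℕ.≤ K → ∣ P K - toℚ f ∣ < ε
  converges-of-scaled-bounds f c P X Q Q>0 P*Q≡X X≤f*Q K*error≤c*Q = converges-of-error-bound (toℚ f) c P
    (λ K → scaled-≤ (X K) f (Q K) (Q>0 K) (P*Q≡X K) (X≤f*Q K))
    (λ K → scaled-error (X K) f (Q K) c K (Q>0 K) (P*Q≡X K) (K*error≤c*Q K))

open import Data.Fin using (Fin)
open import Data.Integer using (+_)
open import Data.Nat using (suc; _*_; _^_; _≤_)
open import Data.Nat.Properties using (*-mono-<; m^n>0)
open import Data.Product using (Σ; _×_; _,_)
open import Data.Rational using (ℚ; _<_; _/_; ∣_∣; _-_; 0ℚ)
open import Function.Bundles using (_↔_)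
open import Relation.Binary.PropositionalEquality using (cong; trans)

open FiniteSums using (∑-cong)
open BinomialSums using (weight)
open IncidenceMatrices using (IncMat-↔-Fin; incidenceCount; binomial-expansion)
open Limits using (toℚ; partial*4^; converges-of-scaled-bounds)

proposition2 : (n : ℕ) → Σ ℕ λ F →
    (IncMat n ↔ Fin F) ×
    ((ε : ℚ) → 0ℚ < ε → Σ ℕ λ N → (K : ℕ) → N ≤ K →
      ∣ partial n K - (+ F / 1) ∣ < ε)
proposition2 n = total , IncMat-↔-Fin n ,
  converges-of-scaled-bounds total (total * (4 * suc n)) (partial n) scaledSum (λ K → 2 ^ K * 2 ^ K)
    (λ K → *-mono-< (m^n>0 2 K) (m^n>0 2 K))
    (λ K → trans (partial*4^ n K) (cong toℚ (∑-cong K λ k _ → ∑-cong K λ l _ →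
                                     cong (_* (weight K k * weight K l)) (binomial-expansion n k l))))
    scaledSum≤ error-bound
  where open BinomialTransform n (incidenceCount n)
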